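{- Let $\Gamma$ be a finite simple graph. Run the following twin-reduction process on partitions of the vertex set $V\Gamma$: start with the partition $\Pi$ of $V\Gamma$ into singletons; at each step, choose two distinct parts $A,B$ of $\Pi$ that are twins as vertices of the quotient graph $\Gamma/\Pi$, and replace $\Pi$ by the partition obtained by merging $A$ and $B$ into the single part $A\cup B$. Then every partition $\Pi$ obtained at any stage of this process is a sibling partition of $\Gamma$.
   Context: All graphs are finite and simple; $\Gamma(v)$ denotes the set of neighbours of a vertex $v$. Two distinct vertices $v,w$ of a graph are twins if they have the same neighbours except possibly for one another, i.e. $\Gamma(v)\setminus\{w\}=\Gamma(w)\setminus\{v\}$. For a partition $\Pi$ of $V\Gamma$, the quotient graph $\Gamma/\Pi$ is obtained by shrinking each part of $\Pi$ to a single vertex: its vertices are the parts of $\Pi$, and two distinct parts are adjacent when there is an edge of $\Gamma$ between them. A cograph is a graph containing no induced path on four vertices. A sibling partition of $\Gamma$ is a partition of $V\Gamma$ such that (a) the induced subgraph of $\Gamma$ on each part is a cograph, and (b) between any two distinct parts there are either no edges or all possible edges. -}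

module Defs where

open import Data.Nat using (ℕ)
open import Data.Nat.Properties using (_≟_)
open import Data.Fin using (Fin; toℕ)
open import Data.Product using (Σ; ∃; _×_; _,_)
open import Relation.Nullary using (¬_; Dec; yes; no)
open import Relation.Binary.PropositionalEquality using (_≡_; _≢_)

record Graph (n : ℕ) : Set₁ where
  field
    Adj   : Fin n → Fin n → Set
    adj?  : ∀ u v → Dec (Adj u v)
    sym   : ∀ {u v} → Adj u v → Adj v u
    irrefl : ∀ {u} → ¬ Adj u u
open Graph public

-- A partition of Fin n is represented by a labelling  f : Fin n → ℕ ;
-- its parts are the nonempty fibres of f (labels themselves are irrelevant).
Labelling : ℕ → Set
Labelling n = Fin n → ℕ

IsPart : ∀ {n} → Labelling n → ℕ → Set
IsPart {n} f a = Σ (Fin n) λ u → f u ≡ a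

QAdj : ∀ {n} → Graph n → Labelling n → ℕ → ℕ → Set
QAdj {n} G f a b =
  a ≢ b × Σ (Fin n) λ u → Σ (Fin n) λ v → f u ≡ a × f v ≡ b × Adj G u v

QTwins : ∀ {n} → Graph n → Labelling n → ℕ → ℕ → Set
QTwins G f a b =
  ∀ c → IsPart f c → c ≢ a → c ≢ b →
    (QAdj G f c a → QAdj G f c b) × (QAdj G f c b → QAdj G f c a)

merge : ∀ {n} → Labelling n → ℕ → ℕ → Labelling n
merge f a b u with f u ≟ b
... | yes _ = a
... | no  _ = f u

data Reachable {n : ℕ} (G : Graph n) : Labelling n → Set where
  start : Reachable G toℕ
  step  : ∀ {f} a b → Reachable G f → IsPart f a → IsPart f b → a ≢ b →
          QTwins G f a b → Reachable G (merge f a b)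

-- Γ[part a] is a cograph: no induced path w - x - y - z inside part a
-- (distinctness of w,x,y,z follows from the edge/non-edge pattern,
-- irreflexivity and symmetry).
InducedP4 : ∀ {n} → Graph n → Fin n → Fin n → Fin n → Fin n → Set
InducedP4 G w x y z =
  Adj G w x × Adj G x y × Adj G y z ×
  ¬ Adj G w y × ¬ Adj G w z × ¬ Adj G x z

PartCograph : ∀ {n} → Graph n → Labelling n → ℕ → Set
PartCograph G f a =
  ∀ w x y z → f w ≡ a → f x ≡ a → f y ≡ a → f z ≡ a → ¬ InducedP4 G w x y z

IsSiblingPartition : ∀ {n} → Graph n → Labelling n → Set
IsSiblingPartition {n} G f =
  (∀ a → PartCograph G f a) ×
  (∀ (u v u′ v′ : Fin n) → f u ≢ f v → f u ≡ f u′ → f v ≡ f v′ →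
     Adj G u v → Adj G u′ v′)

{-# OPTIONS --safe #-}
-- Merging two twins A, B of the quotient keeps every other part homogeneous
-- to A ∪ B: a part adjacent to A is, by twinness, adjacent to B, hence
-- completely joined to both.  Inside A ∪ B the edges between A and B are all
-- present or all absent, and an induced P4 cannot straddle two such sets:
-- a crossing edge would force its three non-edges, and so all four vertices,
-- onto one side.  Hence every induced P4 in A ∪ B lies in A or in B, which
-- are cographs.
module Submission where

open import Data.Nat using (ℕ; _≟_)
open import Data.Fin using (Fin; toℕ)
open import Data.Fin.Properties using (toℕ-injective)
open import Data.Product using (Σ; _×_; _,_; proj₁; proj₂)
open import Data.Sum using (_⊎_; inj₁; inj₂)
open import Relation.Binary.Definitions using (DecidableEquality)
open import Relation.Nullary using (¬_; yes; no; contradiction)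
open import Relation.Nullary.Decidable using (decidable-stable)
open import Relation.Binary.PropositionalEquality
  using (_≡_; _≢_; refl; sym; trans; subst)
open import Defs hiding (sym)

Homogeneous : ∀ {n} → Graph n → Labelling n → Set
Homogeneous {n} G f =
  ∀ (u v u′ v′ : Fin n) → f u ≢ f v → f u ≡ f u′ → f v ≡ f v′ →
    Adj G u v → Adj G u′ v′

module _ {V C : Set} (E : V → V → Set) (κ : V → C) (_≟C_ : DecidableEquality C)
  (crossing-uniform : ∀ u v u′ v′ → κ u ≢ κ v → κ u′ ≢ κ v′ → E u v → E u′ v′)
  where

  induced-P4-monochromatic : ∀ {w x y z} →
    E w x → E x y → E y z → ¬ E w y → ¬ E w z → ¬ E x z →
    κ x ≡ κ w × κ y ≡ κ w × κ z ≡ κ w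
  induced-P4-monochromatic {w} {x} {y} {z} wx xy yz ¬wy ¬wz ¬xz =
    sym wx-same , sym (trans wx-same xy-same) ,
    sym (trans wx-same (trans xy-same yz-same))
    where
    non-edge-same : ∀ {u v p q} → κ u ≢ κ v → E u v → ¬ E p q → κ p ≡ κ q
    non-edge-same {p = p} {q} crossing uv ¬pq =
      decidable-stable (κ p ≟C κ q) λ κp≢κq → ¬pq (crossing-uniform _ _ p q crossing κp≢κq uv)

    crossing-edge-collapses : ∀ {u v} → κ u ≢ κ v → E u v →
      κ w ≡ κ x × κ x ≡ κ y × κ y ≡ κ z
    crossing-edge-collapses crossing uv =
      trans wz (sym xz) , trans xz (trans (sym wz) wy) , trans (sym wy) wz
      where
      wy = non-edge-same crossing uv ¬wy
      wz = non-edge-same crossing uv ¬wz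
      xz = non-edge-same crossing uv ¬xz

    wx-same : κ w ≡ κ x
    wx-same = decidable-stable (κ w ≟C κ x) λ c → c (proj₁ (crossing-edge-collapses c wx))

    xy-same : κ x ≡ κ y
    xy-same = decidable-stable (κ x ≟C κ y) λ c →
      c (proj₁ (proj₂ (crossing-edge-collapses c xy)))

    yz-same : κ y ≡ κ z
    yz-same = decidable-stable (κ y ≟C κ z) λ c →
      c (proj₂ (proj₂ (crossing-edge-collapses c yz)))

module _ {n} (G : Graph n) {f : Labelling n} where

  Adj⇒QAdj : ∀ {u v} → f u ≢ f v → Adj G u v → QAdj G f (f u) (f v)
  Adj⇒QAdj {u} {v} fu≢fv uv = fu≢fv , u , v , refl , refl , uv

  QAdj⇒Adj : Homogeneous G f → ∀ {u v} → QAdj G f (f u) (f v) → Adj G u v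
  QAdj⇒Adj hom {u} {v} (fu≢fv , p , q , fp≡fu , fq≡fv , pq) =
    hom p q u v (λ fp≡fq → fu≢fv (trans (sym fp≡fu) (trans fp≡fq fq≡fv)))
      fp≡fu fq≡fv pq

  homogeneous-swap : Homogeneous G f → ∀ {u v u′ v′} →
    f u ≢ f v → f u ≡ f v′ → f v ≡ f u′ → Adj G u v → Adj G u′ v′
  homogeneous-swap hom {u} {v} {u′} {v′} fu≢fv fu≡fv′ fv≡fu′ uv =
    hom v u u′ v′ (λ e → fu≢fv (sym e)) fv≡fu′ fu≡fv′ (Graph.sym G uv)

  homogeneous-from-one-side :
    (∀ {u u′ v} → f u ≢ f v → f u ≡ f u′ → Adj G u v → Adj G u′ v) →
    Homogeneous G f
  homogeneous-from-one-side move u v u′ v′ fu≢fv fu≡fu′ fv≡fv′ uv =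
    Graph.sym G (move fv≢fu′ fv≡fv′ (Graph.sym G (move fu≢fv fu≡fu′ uv)))
    where
    fv≢fu′ : f v ≢ f u′
    fv≢fu′ e = fu≢fv (trans fu≡fu′ (sym e))

singletons-sibling : ∀ {n} (G : Graph n) → IsSiblingPartition G toℕ
singletons-sibling G = cographs , homogeneous
  where
  cographs : ∀ c → PartCograph G toℕ c
  cographs c w x y z w∈c x∈c _ _ (wx , _) with toℕ-injective (trans w∈c (sym x∈c))
  ... | refl = irrefl G wx

  homogeneous : Homogeneous G toℕ
  homogeneous u v u′ v′ _ u≡u′ v≡v′ uv with toℕ-injective u≡u′ | toℕ-injective v≡v′
  ... | refl | refl = uv

module _ {n} (f : Labelling n) (a b : ℕ) where

  private
    g = merge f a b

  merge-spec : ∀ u → (f u ≡ b × g u ≡ a) ⊎ (f u ≢ b × g u ≡ f u)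
  merge-spec u with f u ≟ b
  ... | yes fu≡b = inj₁ (fu≡b , refl)
  ... | no  fu≢b = inj₂ (fu≢b , refl)

  merge-cong : ∀ {u v} → f u ≡ f v → g u ≡ g v
  merge-cong {u} {v} fu≡fv with merge-spec u | merge-spec v
  ... | inj₁ (_ , gu≡a) | inj₁ (_ , gv≡a) = trans gu≡a (sym gv≡a)
  ... | inj₁ (fu≡b , _) | inj₂ (fv≢b , _) = contradiction (trans (sym fu≡fv) fu≡b) fv≢b
  ... | inj₂ (fu≢b , _) | inj₁ (fv≡b , _) = contradiction (trans fu≡fv fv≡b) fu≢b
  ... | inj₂ (_ , gu≡fu) | inj₂ (_ , gv≡fv) = trans gu≡fu (trans fu≡fv (sym gv≡fv))

  merge-merged : ∀ {u} → f u ≡ a ⊎ f u ≡ b → g u ≡ a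
  merge-merged {u} fu∈ab with merge-spec u | fu∈ab
  ... | inj₁ (_ , gu≡a) | _ = gu≡a
  ... | inj₂ (_ , gu≡fu) | inj₁ fu≡a = trans gu≡fu fu≡a
  ... | inj₂ (fu≢b , _) | inj₂ fu≡b = contradiction fu≡b fu≢b

  merge-outside : ∀ {u} → g u ≢ a → f u ≢ a × f u ≢ b
  merge-outside gu≢a = (λ fu≡a → gu≢a (merge-merged (inj₁ fu≡a)))
                     , (λ fu≡b → gu≢a (merge-merged (inj₂ fu≡b)))

  merge-unmerged : ∀ {u c} → g u ≡ c → c ≢ a → f u ≡ c
  merge-unmerged {u} gu≡c c≢a with merge-spec u
  ... | inj₁ (_ , gu≡a) = contradiction (trans (sym gu≡c) gu≡a) c≢a
  ... | inj₂ (_ , gu≡fu) = trans (sym gu≡fu) gu≡c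

  Straddles : Fin n → Fin n → Set
  Straddles u v = (f u ≡ a × f v ≡ b) ⊎ (f u ≡ b × f v ≡ a)

  straddles-align : ∀ {u v u′ v′} → Straddles u v → Straddles u′ v′ →
    (f u ≡ f u′ × f v ≡ f v′) ⊎ (f u ≡ f v′ × f v ≡ f u′)
  straddles-align (inj₁ (ua , vb)) (inj₁ (u′a , v′b)) = inj₁ (trans ua (sym u′a) , trans vb (sym v′b))
  straddles-align (inj₂ (ub , va)) (inj₂ (u′b , v′a)) = inj₁ (trans ub (sym u′b) , trans va (sym v′a))
  straddles-align (inj₁ (ua , vb)) (inj₂ (u′b , v′a)) = inj₂ (trans ua (sym v′a) , trans vb (sym u′b))
  straddles-align (inj₂ (ub , va)) (inj₁ (u′a , v′b)) = inj₂ (trans ub (sym v′b) , trans va (sym u′a))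

  straddles-merged : ∀ {u v} → Straddles u v → g u ≡ a
  straddles-merged (inj₁ (fu≡a , _)) = merge-merged (inj₁ fu≡a)
  straddles-merged (inj₂ (fu≡b , _)) = merge-merged (inj₂ fu≡b)

  merge-collision : ∀ {u v} → f u ≢ f v → g u ≡ g v → Straddles u v
  merge-collision {u} {v} fu≢fv gu≡gv with merge-spec u | merge-spec v
  ... | inj₁ (fu≡b , _) | inj₁ (fv≡b , _) = contradiction (trans fu≡b (sym fv≡b)) fu≢fv
  ... | inj₁ (fu≡b , gu≡a) | inj₂ (_ , gv≡fv) =
    inj₂ (fu≡b , trans (sym gv≡fv) (trans (sym gu≡gv) gu≡a))
  ... | inj₂ (_ , gu≡fu) | inj₁ (fv≡b , gv≡a) =
    inj₁ (trans (sym gu≡fu) (trans gu≡gv gv≡a) , fv≡b)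
  ... | inj₂ (_ , gu≡fu) | inj₂ (_ , gv≡fv) =
    contradiction (trans (sym gu≡fu) (trans gu≡gv gv≡fv)) fu≢fv

module MergeTwins {n} (G : Graph n) {f : Labelling n} {a b : ℕ}
  (cographs : ∀ c → PartCograph G f c) (homogeneous : Homogeneous G f)
  (twins : QTwins G f a b) where

  private
    g = merge f a b

  MergedPart : Set
  MergedPart = Σ (Fin n) λ u → g u ≡ a

  merged-part-crossing-uniform : ∀ (p q p′ q′ : MergedPart) →
    f (proj₁ p) ≢ f (proj₁ q) → f (proj₁ p′) ≢ f (proj₁ q′) →
    Adj G (proj₁ p) (proj₁ q) → Adj G (proj₁ p′) (proj₁ q′)
  merged-part-crossing-uniform (u , gu) (v , gv) (u′ , gu′) (v′ , gv′) fu≢fv fu′≢fv′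
    with straddles-align f a b (merge-collision f a b fu≢fv (trans gu (sym gv)))
                               (merge-collision f a b fu′≢fv′ (trans gu′ (sym gv′)))
  ... | inj₁ (fu≡fu′ , fv≡fv′) = homogeneous u v u′ v′ fu≢fv fu≡fu′ fv≡fv′
  ... | inj₂ (fu≡fv′ , fv≡fu′) = homogeneous-swap G homogeneous fu≢fv fu≡fv′ fv≡fu′

  merged-part-cograph : PartCograph G g a
  merged-part-cograph w x y z gw gx gy gz p4@(wx , xy , yz , ¬wy , ¬wz , ¬xz) =
    cographs (f w) w x y z refl (proj₁ same) (proj₁ (proj₂ same)) (proj₂ (proj₂ same)) p4
    where
    same : f x ≡ f w × f y ≡ f w × f z ≡ f w
    same = induced-P4-monochromatic {V = MergedPart}
      (λ p q → Adj G (proj₁ p) (proj₁ q)) (λ p → f (proj₁ p)) _≟_ merged-part-crossing-uniform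
      {w , gw} {x , gx} {y , gy} {z , gz} wx xy yz ¬wy ¬wz ¬xz

  merge-cographs : ∀ c → PartCograph G g c
  merge-cographs c with c ≟ a
  ... | yes refl = merged-part-cograph
  ... | no c≢a = λ w x y z gw gx gy gz → cographs c w x y z
    (merge-unmerged f a b gw c≢a) (merge-unmerged f a b gx c≢a)
    (merge-unmerged f a b gy c≢a) (merge-unmerged f a b gz c≢a)

  twins-outside : ∀ {v} → g v ≢ a →
    (QAdj G f (f v) a → QAdj G f (f v) b) × (QAdj G f (f v) b → QAdj G f (f v) a)
  twins-outside {v} gv≢a = twins (f v) (v , refl) (proj₁ outside) (proj₂ outside)
    where
    outside = merge-outside f a b gv≢a

  twins-transfer : ∀ {u u′ v} → g u ≡ g u′ → g v ≢ g u →
    QAdj G f (f v) (f u) → QAdj G f (f v) (f u′)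
  twins-transfer {u} {u′} {v} gu≡gu′ gv≢gu vu with f u ≟ f u′
  ... | yes fu≡fu′ = subst (QAdj G f (f v)) fu≡fu′ vu
  ... | no fu≢fu′ = transfer (merge-collision f a b fu≢fu′ gu≡gu′)
    where
    gv≢a : Straddles f a b u u′ → g v ≢ a
    gv≢a straddle gv≡a = gv≢gu (trans gv≡a (sym (straddles-merged f a b straddle)))

    transfer : Straddles f a b u u′ → QAdj G f (f v) (f u′)
    transfer s@(inj₁ (fu≡a , fu′≡b)) = subst (QAdj G f (f v)) (sym fu′≡b)
      (proj₁ (twins-outside (gv≢a s)) (subst (QAdj G f (f v)) fu≡a vu))
    transfer s@(inj₂ (fu≡b , fu′≡a)) = subst (QAdj G f (f v)) (sym fu′≡a)
      (proj₂ (twins-outside (gv≢a s)) (subst (QAdj G f (f v)) fu≡b vu))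

  merge-move-endpoint : ∀ {u u′ v} → g u ≢ g v → g u ≡ g u′ → Adj G u v → Adj G u′ v
  merge-move-endpoint gu≢gv gu≡gu′ uv =
    Graph.sym G (QAdj⇒Adj G homogeneous
      (twins-transfer gu≡gu′ (λ e → gu≢gv (sym e))
        (Adj⇒QAdj G (λ e → gu≢gv (merge-cong f a b (sym e))) (Graph.sym G uv))))

  merge-sibling : IsSiblingPartition G g
  merge-sibling = merge-cographs , homogeneous-from-one-side G merge-move-endpoint

mainTheorem1 : ∀ {n : ℕ} (G : Graph n) (f : Labelling n) →
    Reachable G f → IsSiblingPartition G f
mainTheorem1 G _ start = singletons-sibling G
mainTheorem1 G _ (step _ _ reachable _ _ _ twins) =
  MergeTwins.merge-sibling G (proj₁ sibling) (proj₂ sibling) twins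
  where
  sibling = mainTheorem1 G _ reachable
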